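{- Let $K$ be a quadratic field with fundamental discriminant $D_K$ and ring of integers $\mathbb{Z}+\mathbb{Z}\omega$, let $f\ge1$ be an integer, $O_f=\mathbb{Z}+\mathbb{Z}f\omega$, $D=f^2D_K$, and let $p$ be a prime with $p\mid f$. Let $N:K_p^{\times}\to\mathbb{Q}_p^{\times}$ be the norm and $O_{f,p}=O_f\otimes\mathbb{Z}_p$. (1) If $p$ is odd, then $N(O_{f,p}^{\times})=(\mathbb{Z}_p^{\times})^2$. (2) If $p=2$, then $N(O_{f,2}^{\times})$ equals: (i) $\mathbb{Z}_2^{\times}$ if $\mathrm{ord}_2(f)=1$ and $D_K$ is odd; (ii) $1+4\mathbb{Z}_2$ if $\mathrm{ord}_2(f)=1$ and $D_K\equiv 12 \pmod{16}$; (iii) $1+4\mathbb{Z}_2$ if $\mathrm{ord}_2(f)=2$ and $D_K\equiv 1\pmod 4$; (iv) $1+8\mathbb{Z}_2$ if $D\equiv 0\pmod{32}$.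
   Context: $(\mathbb{Z}_p^{\times})^2$ denotes the set of squares in $\mathbb{Z}_p^{\times}$; $\mathrm{ord}_p$ is the $p$-adic valuation. $K_p=K\otimes_{\mathbb{Q}}\mathbb{Q}_p$. -}

module Defs where

open import Data.Nat as ℕ using (ℕ; suc)
open import Data.Integer using (ℤ; +_; _+_; _-_; _*_; -_; ∣_∣)
open import Data.Integer.Divisibility.Signed using (_∣_; ∣m∣n⇒∣m+n; ∣n⇒∣m*n; ∣m⇒∣m*n)
open import Data.Integer.Tactic.RingSolver using (solve-∀)
open import Data.Product using (Σ; ∃; _×_; _,_; proj₁; proj₂)
open import Data.Nat.Divisibility as ℕD using ()
open import Relation.Binary.PropositionalEquality using (_≡_; subst; sym)
open import Relation.Nullary using (¬_)

-- The p-adic integers ℤ_p = lim ℤ/p^k ℤ, realised as coherent sequences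
-- of integers: x = (x₀, x₁, …) with x_{k+1} ≡ x_k (mod p^k).

_≡_[mod_] : ℤ → ℤ → ℤ → Set
a ≡ b [mod m ] = m ∣ (a - b)

record ℤₚ (p : ℕ) : Set where
  constructor mkℤₚ
  field
    seq : ℕ → ℤ
    coh : ∀ k → seq (suc k) ≡ seq k [mod + (p ℕ.^ k) ]
open ℤₚ public

module _ {p : ℕ} where

  infix 4 _≈ₚ_
  _≈ₚ_ : ℤₚ p → ℤₚ p → Set
  x ≈ₚ y = ∀ k → seq x k ≡ seq y k [mod + (p ℕ.^ k) ]

  private
    add-lem : ∀ m a a' b b' → a ≡ a' [mod m ] → b ≡ b' [mod m ] →
              (a + b) ≡ (a' + b') [mod m ]
    add-lem m a a' b b' h1 h2 =
      subst (m ∣_) (eq a a' b b') (∣m∣n⇒∣m+n h1 h2)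
      where
      eq : ∀ a a' b b' → (a - a') + (b - b') ≡ (a + b) - (a' + b')
      eq = solve-∀

    mul-lem : ∀ m a a' b b' → a ≡ a' [mod m ] → b ≡ b' [mod m ] →
              (a * b) ≡ (a' * b') [mod m ]
    mul-lem m a a' b b' h1 h2 =
      subst (m ∣_) (eq a a' b b') (∣m∣n⇒∣m+n (∣n⇒∣m*n a h2) (∣m⇒∣m*n b' h1))
      where
      eq : ∀ a a' b b' → a * (b - b') + (a - a') * b' ≡ (a * b) - (a' * b')
      eq = solve-∀

    const-lem : ∀ m a → a ≡ a [mod m ]
    const-lem m a = subst (m ∣_) (eq a) (∣n⇒∣m*n (+ 0) {m} (Data.Integer.Divisibility.Signed.∣-refl))
      where
      eq : ∀ a → + 0 * m ≡ a - a
      eq = solve-∀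

  ι : ℤ → ℤₚ p
  ι a = mkℤₚ (λ _ → a) (λ k → const-lem _ a)

  infixl 6 _+ₚ_
  infixl 7 _*ₚ_
  _+ₚ_ : ℤₚ p → ℤₚ p → ℤₚ p
  x +ₚ y = mkℤₚ (λ k → seq x k + seq y k) (λ k → add-lem _ (seq x (suc k)) (seq x k) (seq y (suc k)) (seq y k) (coh x k) (coh y k))

  _*ₚ_ : ℤₚ p → ℤₚ p → ℤₚ p
  x *ₚ y = mkℤₚ (λ k → seq x k * seq y k) (λ k → mul-lem _ (seq x (suc k)) (seq x k) (seq y (suc k)) (seq y k) (coh x k) (coh y k))

  IsUnitₚ : ℤₚ p → Set
  IsUnitₚ x = Σ (ℤₚ p) λ y → x *ₚ y ≈ₚ ι (+ 1)

  IsUnitSquareₚ : ℤₚ p → Set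
  IsUnitSquareₚ x = Σ (ℤₚ p) λ y → IsUnitₚ y × (x ≈ₚ y *ₚ y)

  In1+_ℤₚ : ℤ → ℤₚ p → Set
  (In1+ m ℤₚ) x = Σ (ℤₚ p) λ z → x ≈ₚ ι (+ 1) +ₚ ι m *ₚ z

SquareFreeℤ : ℤ → Set
SquareFreeℤ n = ∀ (d : ℕ) → (d ℕ.* d) ℕD.∣ ∣ n ∣ → d ≡ 1

IsFundamentalDiscriminant : ℤ → Set
IsFundamentalDiscriminant D =
  ¬ (D ≡ + 1) ×
  ( (D ≡ + 1 [mod + 4 ] × SquareFreeℤ D)
    Data.Sum.⊎ Σ ℤ λ m → D ≡ + 4 * m × (m ≡ + 2 [mod + 4 ] Data.Sum.⊎ m ≡ + 3 [mod + 4 ]) × SquareFreeℤ m )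
  where import Data.Sum

-- The ring of integers of K = ℚ(√D_K) is ℤ + ℤω where ω is a root of
-- X² - tX + n with t² - 4n = D_K  (i.e. ω = (t + √D_K)/2).
-- The order O_f = ℤ + ℤ fω, and O_{f,p} = O_f ⊗ ℤ_p = ℤ_p + ℤ_p θ with
-- θ = fω satisfying θ² = (f t) θ - f² n.
-- An element a + bθ of O_{f,p} is represented by the pair (a , b).

module Order (p : ℕ) (t n : ℤ) (f : ℕ) where

  Ofp : Set
  Ofp = ℤₚ p × ℤₚ p

  _≈O_ : Ofp → Ofp → Set
  (a , b) ≈O (c , d) = (a ≈ₚ c) × (b ≈ₚ d)

  -- (a + bθ)(c + dθ) = (ac - bd f² n) + (ad + bc + bd f t) θ
  _*O_ : Ofp → Ofp → Ofp
  (a , b) *O (c , d) =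
    ( a *ₚ c +ₚ ι (- (+ f * + f * n)) *ₚ b *ₚ d
    , a *ₚ d +ₚ b *ₚ c +ₚ ι (+ f * t) *ₚ b *ₚ d )

  oneO : Ofp
  oneO = (ι (+ 1) , ι (+ 0))

  IsUnitO : Ofp → Set
  IsUnitO x = Σ Ofp λ y → (x *O y) ≈O oneO

  normO : Ofp → ℤₚ p
  normO (a , b) = a *ₚ a +ₚ ι (+ f * t) *ₚ a *ₚ b +ₚ ι (+ f * + f * n) *ₚ b *ₚ b

  InNormUnits : ℤₚ p → Set
  InNormUnits u = Σ Ofp λ x → IsUnitO x × (normO x ≈ₚ u)

{-# OPTIONS --safe #-}
-- The norm of a + bθ ∈ O_{f,p} is the binary quadratic form a² + T ab + F b² with T = f t, F = f² n,
-- and a + bθ is a unit exactly when its norm is a unit of ℤ_p.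
-- For odd p ∣ f the form is ≡ a² mod p, so norms of units are squares mod p and hence, by Hensel's lemma,
-- squares of units; conversely y² is the norm of y. For p = 2 the same reduction, modulo 4 when 4 ∣ T, F
-- and modulo 8 after completing the square when 32 ∣ f² D_K, shows that norms of units are ≡ 1 mod 4
-- resp. 8. Conversely, each odd residue mod 8 allowed in the case at hand is a value of the form at
-- integers α, β; a 2-adic unit u ≡ m mod 8 with m odd is m times the square of a unit y (Hensel again),
-- so u is the norm of (α + βθ) y.
module Submission where

open import Defs
open import Data.Nat using (ℕ; _≤_)
open import Data.Nat.Divisibility using () renaming (_∣_ to _∣ℕ_)
open import Data.Nat.Primality using (Prime)
open import Data.Integer using (ℤ; +_; _-_; _*_)
open import Data.Integer.Divisibility.Signed using (_∣_)
open import Data.Product using (_×_)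
open import Function.Bundles using (_⇔_)
open import Relation.Binary.PropositionalEquality using (_≡_; _≢_)
open import Relation.Nullary using (¬_)

open import Data.Nat as ℕ using (zero; suc)
import Data.Nat.Properties as ℕP
import Data.Nat.Divisibility as ℕD
import Data.Nat.Primality as Pr
open import Data.Integer using (_+_; -_)
import Data.Integer.Properties as ℤP
import Data.Integer.DivMod as ℤDM
open import Data.Integer.Divisibility.Signed
  using (divides; ∣-refl; ∣-trans; ∣m∣n⇒∣m+n; ∣m⇒∣-m; ∣n⇒∣m*n; ∣m⇒∣m*n; ∣⇒∣ᵤ; ∣ᵤ⇒∣; *-cancelʳ-∣)
open import Data.Integer.Tactic.RingSolver using (solve-∀)
open import Data.Product using (Σ; _,_; proj₁; proj₂)
open import Data.Sum using (_⊎_; inj₁; inj₂)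
open import Data.Empty using (⊥-elim)
open import Function.Bundles using (mk⇔)
open import Level using (0ℓ)
open import Relation.Binary.Bundles using (Setoid)
open import Relation.Binary.Structures using (IsEquivalence)
import Relation.Binary.Reasoning.Setoid as SetoidReasoning
open import Relation.Binary.PropositionalEquality using (refl; sym; trans; cong; cong₂; subst; subst₂; module ≡-Reasoning)

∣-respʳ : ∀ {m x y} → x ≡ y → m ∣ x → m ∣ y
∣-respʳ refl d = d

mod-reflexive : ∀ {m a b} → a ≡ b → a ≡ b [mod m ]
mod-reflexive {a = a} refl = divides (+ 0) (ℤP.+-inverseʳ a)

mod-refl : ∀ {m a} → a ≡ a [mod m ]
mod-refl {a = a} = mod-reflexive {a = a} refl

mod-sym : ∀ {m a b} → a ≡ b [mod m ] → b ≡ a [mod m ]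
mod-sym {a = a} {b = b} h = ∣-respʳ (negate a b) (∣m⇒∣-m h)
  where
  negate : ∀ a b → - (a - b) ≡ b - a
  negate = solve-∀

mod-trans : ∀ {m a b c} → a ≡ b [mod m ] → b ≡ c [mod m ] → a ≡ c [mod m ]
mod-trans {a = a} {b = b} {c = c} h₁ h₂ = ∣-respʳ (telescope a b c) (∣m∣n⇒∣m+n h₁ h₂)
  where
  telescope : ∀ a b c → (a - b) + (b - c) ≡ a - c
  telescope = solve-∀

mod-1 : ∀ a b → a ≡ b [mod + 1 ]
mod-1 a b = divides (a - b) (sym (ℤP.*-identityʳ (a - b)))

mod-isEquivalence : (m : ℤ) → IsEquivalence (_≡_[mod m ])
mod-isEquivalence m = record
  { refl = λ {a} → mod-refl {a = a}
  ; sym = λ {a} {b} → mod-sym {a = a} {b}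
  ; trans = λ {a} {b} {c} → mod-trans {a = a} {b} {c}
  }

mod-setoid : ℤ → Setoid 0ℓ 0ℓ
mod-setoid m = record { isEquivalence = mod-isEquivalence m }

module ≡-mod-Reasoning (m : ℤ) = SetoidReasoning (mod-setoid m)

mod-+ : ∀ {m} a a' b b' → a ≡ a' [mod m ] → b ≡ b' [mod m ] → (a + b) ≡ (a' + b') [mod m ]
mod-+ a a' b b' h₁ h₂ = ∣-respʳ (regroup a a' b b') (∣m∣n⇒∣m+n h₁ h₂)
  where
  regroup : ∀ a a' b b' → (a - a') + (b - b') ≡ (a + b) - (a' + b')
  regroup = solve-∀

mod-* : ∀ {m} a a' b b' → a ≡ a' [mod m ] → b ≡ b' [mod m ] → (a * b) ≡ (a' * b') [mod m ]
mod-* a a' b b' h₁ h₂ = ∣-respʳ (regroup a a' b b') (∣m∣n⇒∣m+n (∣n⇒∣m*n a h₂) (∣m⇒∣m*n b' h₁))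
  where
  regroup : ∀ a a' b b' → a * (b - b') + (a - a') * b' ≡ (a * b) - (a' * b')
  regroup = solve-∀

Even Odd : ℤ → Set
Even x = Σ ℤ λ q → x ≡ + 2 * q
Odd x = Σ ℤ λ q → x ≡ + 2 * q + + 1

parity : ∀ x → Even x ⊎ Odd x
parity x = classify (x ℤDM.%ℕ 2) (ℤDM.n%ℕd<d x 2) (ℤDM.a≡a%ℕn+[a/ℕn]*n x 2)
  where
  q = x ℤDM./ℕ 2
  even-form : ∀ q → + 0 + q * + 2 ≡ + 2 * q
  even-form = solve-∀
  odd-form : ∀ q → + 1 + q * + 2 ≡ + 2 * q + + 1
  odd-form = solve-∀
  classify : ∀ r → r ℕ.< 2 → x ≡ + r + q * + 2 → Even x ⊎ Odd x
  classify 0 _ e = inj₁ (q , trans e (even-form q))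
  classify 1 _ e = inj₂ (q , trans e (odd-form q))
  classify (suc (suc _)) (ℕ.s≤s (ℕ.s≤s ())) _

2∤1 : ¬ (+ 2 ∣ + 1)
2∤1 2∣1 with ℕD.∣1⇒≡1 (∣⇒∣ᵤ 2∣1)
... | ()

even⇒¬odd : ∀ {x} → Even x → ¬ Odd x
even⇒¬odd (q , refl) (q' , 2q≡2q'+1) = 2∤1 (divides (q - q') (begin
  + 1                          ≡⟨ difference q' ⟩
  (+ 2 * q' + + 1) - + 2 * q'  ≡⟨ cong (_- + 2 * q') 2q≡2q'+1 ⟨
  + 2 * q - + 2 * q'           ≡⟨ factor q q' ⟩
  (q - q') * + 2               ∎))
  where
  open ≡-Reasoning
  difference : ∀ q' → + 1 ≡ (+ 2 * q' + + 1) - + 2 * q'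
  difference = solve-∀
  factor : ∀ q q' → + 2 * q - + 2 * q' ≡ (q - q') * + 2
  factor = solve-∀

2∣⇒even : ∀ {x} → + 2 ∣ x → Even x
2∣⇒even (divides q x≡q2) = q , trans x≡q2 (ℤP.*-comm q (+ 2))

¬2∣⇒odd : ∀ {x} → ¬ (+ 2 ∣ x) → Odd x
¬2∣⇒odd {x} 2∤x with parity x
... | inj₁ (q , x≡2q) = ⊥-elim (2∤x (divides q (trans x≡2q (ℤP.*-comm (+ 2) q))))
... | inj₂ x-odd = x-odd

odd⇒≡1-mod-2 : ∀ {x} → Odd x → x ≡ + 1 [mod + 2 ]
odd⇒≡1-mod-2 (q , refl) = divides q (minus-one q)
  where
  minus-one : ∀ q → (+ 2 * q + + 1) - + 1 ≡ q * + 2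
  minus-one = solve-∀

≡1-mod-2⇒odd : ∀ {x} → x ≡ + 1 [mod + 2 ] → Odd x
≡1-mod-2⇒odd {x} (divides q e) = q , trans (plus-one x) (trans (cong (_+ + 1) e) (swap q))
  where
  plus-one : ∀ x → x ≡ (x - + 1) + + 1
  plus-one = solve-∀
  swap : ∀ q → q * + 2 + + 1 ≡ + 2 * q + + 1
  swap = solve-∀

invertible-mod-2⇒odd : ∀ {x} w → (x * w) ≡ + 1 [mod + 2 ] → Odd x
invertible-mod-2⇒odd {x} w h with parity x
... | inj₂ odd = odd
... | inj₁ (q , refl) = ⊥-elim (even⇒¬odd (q * w , reassoc q w) (≡1-mod-2⇒odd h))
  where
  reassoc : ∀ q w → + 2 * q * w ≡ + 2 * (q * w)
  reassoc = solve-∀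

even-*-suc : ∀ x → Even (x * (x + + 1))
even-*-suc x with parity x
... | inj₁ (q , refl) = q * (+ 2 * q + + 1) , expand q
  where
  expand : ∀ q → + 2 * q * (+ 2 * q + + 1) ≡ + 2 * (q * (+ 2 * q + + 1))
  expand = solve-∀
... | inj₂ (q , refl) = (+ 2 * q + + 1) * (q + + 1) , expand q
  where
  expand : ∀ q → (+ 2 * q + + 1) * (+ 2 * q + + 1 + + 1) ≡ + 2 * ((+ 2 * q + + 1) * (q + + 1))
  expand = solve-∀

-- (2q + 1)² - 1 = 4 q (q + 1), and q (q + 1) is even.
odd²≡1-mod-8 : ∀ {w} → Odd w → (w * w) ≡ + 1 [mod + 8 ]
odd²≡1-mod-8 (q , refl) with even-*-suc q
... | e , eq = divides e (trans (expand q) (trans (cong (+ 4 *_) eq) (regroup e)))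
  where
  expand : ∀ q → (+ 2 * q + + 1) * (+ 2 * q + + 1) - + 1 ≡ + 4 * (q * (q + + 1))
  expand = solve-∀
  regroup : ∀ e → + 4 * (+ 2 * e) ≡ e * + 8
  regroup = solve-∀

mod-split : ∀ {m a b} → a ≡ b [mod m ] → a ≡ b [mod + 2 * m ] ⊎ a ≡ b + m [mod + 2 * m ]
mod-split {m} {a} {b} (divides q e) with parity q
... | inj₁ (q' , refl) = inj₁ (divides q' (trans e (even-case q' m)))
  where
  even-case : ∀ q' m → + 2 * q' * m ≡ q' * (+ 2 * m)
  even-case = solve-∀
... | inj₂ (q' , refl) = inj₂ (divides q' (trans (shift a b m) (trans (cong (_- m) e) (odd-case q' m))))
  where
  shift : ∀ a b m → a - (b + m) ≡ (a - b) - m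
  shift = solve-∀
  odd-case : ∀ q' m → (+ 2 * q' + + 1) * m - m ≡ q' * (+ 2 * m)
  odd-case = solve-∀

prime≢2⇒odd : ∀ {p} → Prime p → p ≢ 2 → Odd (+ p)
prime≢2⇒odd {p} p-prime p≢2 with parity (+ p)
... | inj₂ p-odd = p-odd
... | inj₁ (h , p≡2h) with Pr.prime⇒irreducible p-prime (∣⇒∣ᵤ {+ 2} {+ p} (divides h (trans p≡2h (ℤP.*-comm (+ 2) h))))
...   | inj₁ ()
...   | inj₂ 2≡p = ⊥-elim (p≢2 (sym 2≡p))

infixr 8 _^⁺_
_^⁺_ : ℕ → ℕ → ℤ
p ^⁺ k = + (p ℕ.^ k)

^⁺-suc : ∀ p k → p ^⁺ suc k ≡ + p * p ^⁺ k
^⁺-suc p k = ℤP.pos-* p (p ℕ.^ k)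

^⁺-+ : ∀ p j k → p ^⁺ (j ℕ.+ k) ≡ p ^⁺ j * p ^⁺ k
^⁺-+ p j k = trans (cong +_ (ℕP.^-distribˡ-+-* p j k)) (ℤP.pos-* (p ℕ.^ j) (p ℕ.^ k))

^⁺-one : ∀ p → p ^⁺ 1 ≡ + p
^⁺-one p = cong +_ (ℕP.*-identityʳ p)

^⁺-∣-+ʳ : ∀ p j k → p ^⁺ k ∣ p ^⁺ (j ℕ.+ k)
^⁺-∣-+ʳ p j k = divides (p ^⁺ j) (^⁺-+ p j k)

^⁺-∣-+ˡ : ∀ p j k → p ^⁺ j ∣ p ^⁺ (j ℕ.+ k)
^⁺-∣-+ˡ p j k = divides (p ^⁺ k) (trans (^⁺-+ p j k) (ℤP.*-comm (p ^⁺ j) (p ^⁺ k)))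

∣-^⁺-suc : ∀ p k → + p ∣ p ^⁺ suc k
∣-^⁺-suc p k = divides (p ^⁺ k) (trans (^⁺-suc p k) (ℤP.*-comm (+ p) (p ^⁺ k)))

module _ {p : ℕ} where

  ≈ₚ-refl : ∀ (x : ℤₚ p) → x ≈ₚ x
  ≈ₚ-refl x k = mod-refl {a = seq x k}

  ≈ₚ-isEquivalence : IsEquivalence (_≈ₚ_ {p})
  ≈ₚ-isEquivalence = record
    { refl = λ {x} k → mod-refl {a = seq x k}
    ; sym = λ {x} {y} x≈y k → mod-sym {a = seq x k} {seq y k} (x≈y k)
    ; trans = λ {x} {y} {z} x≈y y≈z k → mod-trans {a = seq x k} {seq y k} {seq z k} (x≈y k) (y≈z k)
    }

  *ₚ-cong : ∀ (x x' y y' : ℤₚ p) → x ≈ₚ x' → y ≈ₚ y' → x *ₚ y ≈ₚ x' *ₚ y'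
  *ₚ-cong x x' y y' hx hy k = mod-* (seq x k) (seq x' k) (seq y k) (seq y' k) (hx k) (hy k)

  pointwise⇒≈ₚ : ∀ (x y : ℤₚ p) → (∀ k → seq x k ≡ seq y k) → x ≈ₚ y
  pointwise⇒≈ₚ x y eq k = mod-reflexive {a = seq x k} {seq y k} (eq k)

  digit-coh : ∀ (x : ℤₚ p) j k → seq x (j ℕ.+ k) ≡ seq x k [mod p ^⁺ k ]
  digit-coh x zero k = mod-refl {a = seq x k}
  digit-coh x (suc j) k =
    mod-trans {a = seq x (suc j ℕ.+ k)} {seq x (j ℕ.+ k)}
      (∣-trans (^⁺-∣-+ʳ p j k) (coh x (j ℕ.+ k))) (digit-coh x j k)

  digit-mod-p : ∀ (x : ℤₚ p) k → seq x (suc k) ≡ seq x 1 [mod + p ]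
  digit-mod-p x zero = mod-refl {a = seq x 1}
  digit-mod-p x (suc k) =
    mod-trans {a = seq x (2 ℕ.+ k)} {seq x (suc k)} (∣-trans (∣-^⁺-suc p k) (coh x (suc k))) (digit-mod-p x k)

ℤₚ-setoid : ℕ → Setoid 0ℓ 0ℓ
ℤₚ-setoid p = record { isEquivalence = ≈ₚ-isEquivalence {p} }

module ≈ₚ-Reasoning (p : ℕ) = SetoidReasoning (ℤₚ-setoid p)

≈ₚ-sym : ∀ {p} (x y : ℤₚ p) → x ≈ₚ y → y ≈ₚ x
≈ₚ-sym {p} x y = Setoid.sym (ℤₚ-setoid p) {x} {y}

≈ₚ⇒≡-mod-p : ∀ {p} {x y : ℤₚ p} → x ≈ₚ y → seq x 1 ≡ seq y 1 [mod + p ]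
≈ₚ⇒≡-mod-p {p} {x} {y} x≈y = subst (λ m → seq x 1 ≡ seq y 1 [mod m ]) (^⁺-one p) (x≈y 1)

IsUnitₚ-resp-≈ₚ : ∀ {p} (x y : ℤₚ p) → x ≈ₚ y → IsUnitₚ x → IsUnitₚ y
IsUnitₚ-resp-≈ₚ {p} x y x≈y (w , xw≈1) = w , (begin
  y *ₚ w   ≈⟨ *ₚ-cong x y w w x≈y (≈ₚ-refl w) ⟨
  x *ₚ w   ≈⟨ xw≈1 ⟩
  ι (+ 1)  ∎)
  where open ≈ₚ-Reasoning p

IsUnitₚ-* : ∀ {p} (x y : ℤₚ p) → IsUnitₚ x → IsUnitₚ y → IsUnitₚ (x *ₚ y)
IsUnitₚ-* {p} x y (v , xv≈1) (w , yw≈1) = v *ₚ w , (begin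
  (x *ₚ y) *ₚ (v *ₚ w)  ≈⟨ pointwise⇒≈ₚ ((x *ₚ y) *ₚ (v *ₚ w)) ((x *ₚ v) *ₚ (y *ₚ w)) (λ k → interchange (seq x k) (seq y k) (seq v k) (seq w k)) ⟩
  (x *ₚ v) *ₚ (y *ₚ w)  ≈⟨ *ₚ-cong (x *ₚ v) (ι (+ 1)) (y *ₚ w) (ι (+ 1)) xv≈1 yw≈1 ⟩
  ι (+ 1) *ₚ ι (+ 1)    ≈⟨ pointwise⇒≈ₚ (ι (+ 1) *ₚ ι (+ 1)) (ι (+ 1)) (λ _ → refl) ⟩
  ι (+ 1)               ∎)
  where
  open ≈ₚ-Reasoning p
  interchange : ∀ x y v w → (x * y) * (v * w) ≡ (x * v) * (y * w)
  interchange = solve-∀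

unit-digit-odd : ∀ (u : ℤₚ 2) → IsUnitₚ u → ∀ k → Odd (seq u (suc k))
unit-digit-odd u (w , uw≈1) k = invertible-mod-2⇒odd (seq w (suc k)) (∣-trans (∣-^⁺-suc 2 k) (uw≈1 (suc k)))

In1+-of-digits : ∀ {p} .{{_ : ℕ.NonZero p}} (u : ℤₚ p) j →
                 (∀ k → seq u (j ℕ.+ k) ≡ + 1 [mod p ^⁺ j ]) → (In1+ p ^⁺ j ℤₚ) u
In1+-of-digits {p} u j u≡1 = mkℤₚ z z-coh , u≈1+pʲz
  where
  instance
    pʲ≢0 : ℕ.NonZero (p ℕ.^ j)
    pʲ≢0 = ℕP.m^n≢0 p j
  P = p ^⁺ j
  z : ℕ → ℤ
  z k = _∣_.quotient (u≡1 k)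
  exact : ∀ k → seq u (j ℕ.+ k) ≡ + 1 + P * z k
  exact k = trans (split (seq u (j ℕ.+ k))) (cong (λ X → + 1 + X) (trans (_∣_.equality (u≡1 k)) (ℤP.*-comm (z k) P)))
    where
    split : ∀ U → U ≡ + 1 + (U - + 1)
    split = solve-∀
  z-coh : ∀ k → z (suc k) ≡ z k [mod p ^⁺ k ]
  z-coh k = *-cancelʳ-∣ P (subst₂ _∣_ pʲ⁺ᵏ≡pᵏpʲ difference (coh u (j ℕ.+ k)))
    where
    open ≡-Reasoning
    pʲ⁺ᵏ≡pᵏpʲ : p ^⁺ (j ℕ.+ k) ≡ p ^⁺ k * P
    pʲ⁺ᵏ≡pᵏpʲ = trans (^⁺-+ p j k) (ℤP.*-comm P (p ^⁺ k))
    cancel : ∀ z' z P → (+ 1 + P * z') - (+ 1 + P * z) ≡ (z' - z) * P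
    cancel = solve-∀
    difference : seq u (suc (j ℕ.+ k)) - seq u (j ℕ.+ k) ≡ (z (suc k) - z k) * P
    difference = begin
      seq u (suc (j ℕ.+ k)) - seq u (j ℕ.+ k)  ≡⟨ cong (λ i → seq u i - seq u (j ℕ.+ k)) (ℕP.+-suc j k) ⟨
      seq u (j ℕ.+ suc k) - seq u (j ℕ.+ k)    ≡⟨ cong₂ _-_ (exact (suc k)) (exact k) ⟩
      (+ 1 + P * z (suc k)) - (+ 1 + P * z k)   ≡⟨ cancel (z (suc k)) (z k) P ⟩
      (z (suc k) - z k) * P                    ∎
  u≈1+pʲz : u ≈ₚ ι (+ 1) +ₚ ι P *ₚ mkℤₚ z z-coh
  u≈1+pʲz k = begin
    seq u k            ≈⟨ digit-coh u j k ⟨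
    seq u (j ℕ.+ k)    ≡⟨ exact k ⟩
    + 1 + P * z k      ∎
    where open ≡-mod-Reasoning (p ^⁺ k)

In1+⇒≡1 : ∀ {p} m (u : ℤₚ p) k → m ∣ p ^⁺ k → (In1+ m ℤₚ) u → seq u k ≡ + 1 [mod m ]
In1+⇒≡1 m u k m∣pᵏ (z , u≈1+mz) = begin
  seq u k               ≈⟨ ∣-trans m∣pᵏ (u≈1+mz k) ⟩
  + 1 + m * seq z k     ≈⟨ divides (seq z k) (cancel (seq z k) m) ⟩
  + 1                   ∎
  where
  open ≡-mod-Reasoning m
  cancel : ∀ z m → (+ 1 + m * z) - + 1 ≡ z * m
  cancel = solve-∀

-- Hensel lifting

-- A p-adic integer as the limit of approximations refined one digit at a time; Approx k may
-- demand more than precision p^k, the limit only uses that consecutive terms agree mod p^k.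
module Lifting {p : ℕ} (Approx : ℕ → ℤ → Set) (y₀ : ℤ) (approx₀ : Approx 0 y₀)
  (refine : ∀ k y → Approx k y → Σ ℤ λ y' → Approx (suc k) y' × y' ≡ y [mod p ^⁺ k ]) where

  approximation : ∀ k → Σ ℤ (Approx k)
  approximation zero = y₀ , approx₀
  approximation (suc k) with refine k (proj₁ (approximation k)) (proj₂ (approximation k))
  ... | y' , approx' , _ = y' , approx'

  limit : ℤₚ p
  seq limit k = proj₁ (approximation k)
  coh limit k = proj₂ (proj₂ (refine k (proj₁ (approximation k)) (proj₂ (approximation k))))

  limit-approx : ∀ k → Approx k (seq limit k)
  limit-approx k = proj₂ (approximation k)

invertible-mod-p⇒unit : ∀ {p} (u : ℤₚ p) s → (seq u 1 * s) ≡ + 1 [mod + p ] → IsUnitₚ u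
invertible-mod-p⇒unit {p} u s us≡1 = limit , limit-approx
  where
  Approx : ℕ → ℤ → Set
  Approx k w = (seq u k * w) ≡ + 1 [mod p ^⁺ k ]

  -- Newton's step for 1/u: w ↦ w - (u w - 1) s.
  refine : ∀ k w → Approx k w → Σ ℤ λ w' → Approx (suc k) w' × w' ≡ w [mod p ^⁺ k ]
  refine k w uw≡1 = w - e * s * P , divides (- (e * r)) newton , divides (- (e * s)) (shift w e s P)
    where
    open ≡-Reasoning
    P = p ^⁺ k
    U = seq u (suc k)
    Uw≡1 : (U * w) ≡ + 1 [mod P ]
    Uw≡1 = mod-trans {a = U * w} {seq u k * w} (mod-* U (seq u k) w w (coh u k) (mod-refl {a = w})) uw≡1
    e = _∣_.quotient Uw≡1
    Us≡1 : (U * s) ≡ + 1 [mod + p ]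
    Us≡1 = mod-trans {a = U * s} {seq u 1 * s} (mod-* U (seq u 1) s s (digit-mod-p u k) (mod-refl {a = s})) us≡1
    r = _∣_.quotient Us≡1
    expand : ∀ U w e s P → U * (w - e * s * P) - + 1 ≡ (U * w - + 1) - e * P * (U * s - + 1) - e * P
    expand = solve-∀
    collect : ∀ e P r p → e * P - e * P * (r * p) - e * P ≡ (- (e * r)) * (p * P)
    collect = solve-∀
    shift : ∀ w e s P → (w - e * s * P) - w ≡ (- (e * s)) * P
    shift = solve-∀
    newton : U * (w - e * s * P) - + 1 ≡ (- (e * r)) * p ^⁺ suc k
    newton = begin
      U * (w - e * s * P) - + 1                        ≡⟨ expand U w e s P ⟩
      (U * w - + 1) - e * P * (U * s - + 1) - e * P    ≡⟨ cong₂ (λ X Y → X - e * P * Y - e * P) (_∣_.equality Uw≡1) (_∣_.equality Us≡1) ⟩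
      e * P - e * P * (r * + p) - e * P                ≡⟨ collect e P r (+ p) ⟩
      (- (e * r)) * (+ p * P)                          ≡⟨ cong ((- (e * r)) *_) (^⁺-suc p k) ⟨
      (- (e * r)) * p ^⁺ suc k                         ∎

  open Lifting Approx s (mod-1 (seq u 0 * s) (+ 1)) refine

hensel-√ : ∀ {p} (u : ℤₚ p) a s → (+ 2 * a * s) ≡ + 1 [mod + p ] → seq u 1 ≡ a * a [mod + p ] →
           IsUnitSquareₚ u
hensel-√ {p} u a s 2as≡1 u≡a² = limit , root-unit , u≈root²
  where
  Approx : ℕ → ℤ → Set
  Approx k y = (seq u (suc k) ≡ y * y [mod p ^⁺ suc k ]) × (y ≡ a [mod + p ])

  -- Newton's step for √u: y ↦ y + (u - y²) s, where s plays the role of 1/(2y) mod p.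
  refine : ∀ k y → Approx k y → Σ ℤ λ y' → Approx (suc k) y' × y' ≡ y [mod p ^⁺ k ]
  refine k y (uk≡y² , y≡a) =
    y + e * s * P , (divides ρ newton , y'≡a) , ∣-respʳ (sym (shift y e s P)) (∣n⇒∣m*n (e * s) (^⁺-∣-+ʳ p 1 k))
    where
    open ≡-Reasoning
    P' = p ^⁺ k
    P = p ^⁺ suc k
    U = seq u (2 ℕ.+ k)
    U≡y² : U ≡ y * y [mod P ]
    U≡y² = mod-trans {a = U} {seq u (suc k)} (coh u (suc k)) uk≡y²
    e = _∣_.quotient U≡y²
    r = _∣_.quotient 2as≡1
    q = _∣_.quotient y≡a
    ρ = - (e * (r + + 2 * s * q)) - e * e * s * s * P'
    expand : ∀ U y e s P a → U - (y + e * s * P) * (y + e * s * P) ≡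
             (U - y * y) - e * P * ((+ 2 * a * s - + 1) + + 1 + + 2 * s * (y - a)) - e * e * s * s * P * P
    expand = solve-∀
    collect : ∀ e P' p r s q → e * (p * P') - e * (p * P') * (r * p + + 1 + + 2 * s * (q * p)) - e * e * s * s * (p * P') * (p * P') ≡
              (- (e * (r + + 2 * s * q)) - e * e * s * s * P') * (p * (p * P'))
    collect = solve-∀
    P≡pP' : P ≡ + p * P'
    P≡pP' = ^⁺-suc p k
    newton : U - (y + e * s * P) * (y + e * s * P) ≡ ρ * p ^⁺ (2 ℕ.+ k)
    newton = begin
      U - (y + e * s * P) * (y + e * s * P)
        ≡⟨ expand U y e s P a ⟩
      (U - y * y) - e * P * ((+ 2 * a * s - + 1) + + 1 + + 2 * s * (y - a)) - e * e * s * s * P * P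
        ≡⟨ cong₂ (λ X Y → X - e * P * (Y + + 1 + + 2 * s * (y - a)) - e * e * s * s * P * P) (_∣_.equality U≡y²) (_∣_.equality 2as≡1) ⟩
      e * P - e * P * (r * + p + + 1 + + 2 * s * (y - a)) - e * e * s * s * P * P
        ≡⟨ cong₂ (λ X Y → e * X - e * X * (r * + p + + 1 + + 2 * s * Y) - e * e * s * s * X * X) P≡pP' (_∣_.equality y≡a) ⟩
      e * (+ p * P') - e * (+ p * P') * (r * + p + + 1 + + 2 * s * (q * + p)) - e * e * s * s * (+ p * P') * (+ p * P')
        ≡⟨ collect e P' (+ p) r s q ⟩
      ρ * (+ p * (+ p * P'))
        ≡⟨ cong (λ X → ρ * (+ p * X)) P≡pP' ⟨
      ρ * (+ p * P)
        ≡⟨ cong (ρ *_) (^⁺-suc p (suc k)) ⟨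
      ρ * p ^⁺ (2 ℕ.+ k) ∎
    shift : ∀ y e s P → (y + e * s * P) - y ≡ e * s * P
    shift = solve-∀
    y'≡a : (y + e * s * P) ≡ a [mod + p ]
    y'≡a = ∣-respʳ (regroup y e s P a) (∣m∣n⇒∣m+n y≡a (∣n⇒∣m*n (e * s) (∣-^⁺-suc p k)))
      where
      regroup : ∀ y e s P a → (y - a) + e * s * P ≡ (y + e * s * P) - a
      regroup = solve-∀

  y₀≡a² : seq u 1 ≡ a * a [mod p ^⁺ 1 ]
  y₀≡a² = subst (λ m → seq u 1 ≡ a * a [mod m ]) (sym (^⁺-one p)) u≡a²

  open Lifting Approx a (y₀≡a² , mod-refl {a = a}) refine

  u≈root² : u ≈ₚ limit *ₚ limit
  u≈root² k = mod-trans {a = seq u k} {seq u (suc k)}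
    (mod-sym {a = seq u (suc k)} {seq u k} (coh u k)) (∣-trans (^⁺-∣-+ʳ p 1 k) (proj₁ (limit-approx k)))

  root-unit : IsUnitₚ limit
  root-unit = invertible-mod-p⇒unit limit (+ 2 * s) (begin
    seq limit 1 * (+ 2 * s)  ≈⟨ mod-* (seq limit 1) a (+ 2 * s) (+ 2 * s) (proj₂ (limit-approx 1)) (mod-refl {a = + 2 * s}) ⟩
    a * (+ 2 * s)            ≡⟨ reassoc a s ⟩
    + 2 * a * s              ≈⟨ 2as≡1 ⟩
    + 1                      ∎)
    where
    open ≡-mod-Reasoning (+ p)
    reassoc : ∀ a s → a * (+ 2 * s) ≡ + 2 * a * s
    reassoc = solve-∀

square-mod-p⇒IsUnitSquareₚ : ∀ {p} (u : ℤₚ p) a → Odd (+ p) → IsUnitₚ u → seq u 1 ≡ a * a [mod + p ] →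
                              IsUnitSquareₚ u
square-mod-p⇒IsUnitSquareₚ {p} u a (q , p≡2q+1) (w , uw≈1) u≡a² = hensel-√ u a s 2as≡1 u≡a²
  where
  open ≡-mod-Reasoning (+ p)
  w₁ = seq w 1
  -- (q + 1) is the inverse of 2 modulo p = 2q + 1.
  s = a * w₁ * (q + + 1)
  a²w≡uw : (a * a * w₁) ≡ (seq u 1 * w₁) [mod + p ]
  a²w≡uw = mod-* (a * a) (seq u 1) w₁ w₁ (mod-sym {a = seq u 1} {a * a} u≡a²) (mod-refl {a = w₁})
  p+1≡1 : (+ p + + 1) ≡ + 1 [mod + p ]
  p+1≡1 = divides (+ 1) (drop-one (+ p))
    where
    drop-one : ∀ P → (P + + 1) - + 1 ≡ + 1 * P
    drop-one = solve-∀
  2as≡a²w[p+1] : + 2 * a * s ≡ a * a * w₁ * (+ p + + 1)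
  2as≡a²w[p+1] = trans (regroup a w₁ q) (cong (λ P → a * a * w₁ * (P + + 1)) (sym p≡2q+1))
    where
    regroup : ∀ a w q → + 2 * a * (a * w * (q + + 1)) ≡ a * a * w * ((+ 2 * q + + 1) + + 1)
    regroup = solve-∀
  2as≡1 : (+ 2 * a * s) ≡ + 1 [mod + p ]
  2as≡1 = begin
    + 2 * a * s                  ≡⟨ 2as≡a²w[p+1] ⟩
    a * a * w₁ * (+ p + + 1)     ≈⟨ mod-* (a * a * w₁) (seq u 1 * w₁) (+ p + + 1) (+ 1) a²w≡uw p+1≡1 ⟩
    seq u 1 * w₁ * + 1           ≡⟨ ℤP.*-identityʳ (seq u 1 * w₁) ⟩
    seq u 1 * w₁                 ≈⟨ ≈ₚ⇒≡-mod-p {x = u *ₚ w} {ι (+ 1)} uw≈1 ⟩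
    + 1                          ∎

hensel-√-mod-8 : ∀ (u : ℤₚ 2) m → Odd m → seq u 3 ≡ m [mod + 8 ] →
                 Σ (ℤₚ 2) λ y → IsUnitₚ y × u ≈ₚ ι m *ₚ y *ₚ y
hensel-√-mod-8 u m (μ , refl) u₃≡m = limit , root-unit , u≈m·root²
  where
  Approx : ℕ → ℤ → Set
  Approx k y = (seq u (3 ℕ.+ k) ≡ m * y * y [mod 2 ^⁺ (3 ℕ.+ k) ]) × Odd y

  -- Newton's step y ↦ y + (u - m y²)/2, valid because m y ≡ 1 mod 2.
  refine : ∀ k y → Approx k y → Σ ℤ λ y' → Approx (suc k) y' × y' ≡ y [mod 2 ^⁺ k ]
  refine k y (uk≡my² , (j , refl)) =
    y + e * Q , (divides ρ newton , y'-odd) , ∣-respʳ (sym (shift y e Q)) (∣n⇒∣m*n e (^⁺-∣-+ʳ 2 2 k))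
    where
    open ≡-Reasoning
    Z = 2 ^⁺ k
    Q = 2 ^⁺ (2 ℕ.+ k)
    Q≡4Z : Q ≡ + 4 * Z
    Q≡4Z = ^⁺-+ 2 2 k
    U = seq u (4 ℕ.+ k)
    U≡my² : U ≡ m * y * y [mod 2 ^⁺ (3 ℕ.+ k) ]
    U≡my² = mod-trans {a = U} {seq u (3 ℕ.+ k)} (coh u (3 ℕ.+ k)) uk≡my²
    e = _∣_.quotient U≡my²
    ρ = - (e * (+ 2 * μ * j + μ + j)) - m * e * e * Z
    expand : ∀ U m y e Q → U - m * (y + e * Q) * (y + e * Q) ≡ (U - m * y * y) - + 2 * m * y * e * Q - m * e * e * Q * Q
    expand = solve-∀
    collect : ∀ μ j e Z →
      e * (+ 2 * (+ 4 * Z)) - + 2 * (+ 2 * μ + + 1) * (+ 2 * j + + 1) * e * (+ 4 * Z) - (+ 2 * μ + + 1) * e * e * (+ 4 * Z) * (+ 4 * Z) ≡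
      (- (e * (+ 2 * μ * j + μ + j)) - (+ 2 * μ + + 1) * e * e * Z) * (+ 4 * (+ 4 * Z))
    collect = solve-∀
    newton : U - m * (y + e * Q) * (y + e * Q) ≡ ρ * 2 ^⁺ (4 ℕ.+ k)
    newton = begin
      U - m * (y + e * Q) * (y + e * Q)
        ≡⟨ expand U m y e Q ⟩
      (U - m * y * y) - + 2 * m * y * e * Q - m * e * e * Q * Q
        ≡⟨ cong (λ X → X - + 2 * m * y * e * Q - m * e * e * Q * Q) (_∣_.equality U≡my²) ⟩
      e * 2 ^⁺ (3 ℕ.+ k) - + 2 * m * y * e * Q - m * e * e * Q * Q
        ≡⟨ cong (λ X → e * X - + 2 * m * y * e * Q - m * e * e * Q * Q) (^⁺-suc 2 (2 ℕ.+ k)) ⟩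
      e * (+ 2 * Q) - + 2 * m * y * e * Q - m * e * e * Q * Q
        ≡⟨ cong (λ X → e * (+ 2 * X) - + 2 * m * y * e * X - m * e * e * X * X) Q≡4Z ⟩
      e * (+ 2 * (+ 4 * Z)) - + 2 * m * y * e * (+ 4 * Z) - m * e * e * (+ 4 * Z) * (+ 4 * Z)
        ≡⟨ collect μ j e Z ⟩
      ρ * (+ 4 * (+ 4 * Z))
        ≡⟨ cong (λ X → ρ * (+ 4 * X)) Q≡4Z ⟨
      ρ * (+ 4 * Q)
        ≡⟨ cong (ρ *_) (^⁺-+ 2 2 (2 ℕ.+ k)) ⟨
      ρ * 2 ^⁺ (4 ℕ.+ k) ∎
    shift : ∀ y e Q → (y + e * Q) - y ≡ e * Q
    shift = solve-∀
    odd-form : ∀ j e Z → + 2 * j + + 1 + e * (+ 4 * Z) ≡ + 2 * (j + + 2 * e * Z) + + 1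
    odd-form = solve-∀
    y'-odd : Odd (y + e * Q)
    y'-odd = j + + 2 * e * Z , trans (cong (λ X → y + e * X) Q≡4Z) (odd-form j e Z)

  approx₀ : Approx 0 (+ 1)
  approx₀ = ∣-respʳ (times-one (seq u 3) m) u₃≡m , (+ 0 , refl)
    where
    times-one : ∀ U m → U - m ≡ U - m * + 1 * + 1
    times-one = solve-∀

  open Lifting Approx (+ 1) approx₀ refine

  u≈m·root² : u ≈ₚ ι m *ₚ limit *ₚ limit
  u≈m·root² k = mod-trans {a = seq u k} {seq u (3 ℕ.+ k)}
    (mod-sym {a = seq u (3 ℕ.+ k)} {seq u k} (digit-coh u 3 k)) (∣-trans (^⁺-∣-+ʳ 2 3 k) (proj₁ (limit-approx k)))

  root-unit : IsUnitₚ limit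
  root-unit = invertible-mod-p⇒unit limit (+ 1)
    (subst (_≡ + 1 [mod + 2 ]) (sym (ℤP.*-identityʳ (seq limit 1))) (odd⇒≡1-mod-2 (proj₂ (limit-approx 1))))

-- The norm form

-- seq (normO (a , b)) k is definitionally normForm (f t) (f² n) (seq a k) (seq b k).
normForm : (T F a b : ℤ) → ℤ
normForm T F a b = a * a + T * a * b + F * b * b

normForm-cong : ∀ {m} T F a b c d → a ≡ c [mod m ] → b ≡ d [mod m ] → normForm T F a b ≡ normForm T F c d [mod m ]
normForm-cong T F a b c d a≡c b≡d =
  mod-+ (a * a + T * a * b) (c * c + T * c * d) (F * b * b) (F * d * d)
    (mod-+ (a * a) (c * c) (T * a * b) (T * c * d) (mod-* a c a c a≡c a≡c)
      (mod-* (T * a) (T * c) b d (mod-* T T a c (mod-refl {a = T}) a≡c) b≡d))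
    (mod-* (F * b) (F * d) b d (mod-* F F b d (mod-refl {a = F}) b≡d) b≡d)

normForm≡square : ∀ {m} T F a b → m ∣ T → m ∣ F → normForm T F a b ≡ a * a [mod m ]
normForm≡square T F a b m∣T m∣F =
  ∣-respʳ (sym (difference T F a b)) (∣m∣n⇒∣m+n (∣m⇒∣m*n b (∣m⇒∣m*n a m∣T)) (∣m⇒∣m*n b (∣m⇒∣m*n b m∣F)))
  where
  difference : ∀ T F a b → (a * a + T * a * b + F * b * b) - a * a ≡ T * a * b + F * b * b
  difference = solve-∀

-- Completing the square: normForm (2τ) F a b = (a + τ b)² - (τ² - F) b².
normForm≡square-mod-8 : ∀ τ F a b → + 8 ∣ τ * τ - F →
                        normForm (+ 2 * τ) F a b ≡ (a + τ * b) * (a + τ * b) [mod + 8 ]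
normForm≡square-mod-8 τ F a b 8∣τ²-F =
  ∣-respʳ (completed-square τ F a b) (∣m⇒∣-m (∣m⇒∣m*n b (∣m⇒∣m*n b 8∣τ²-F)))
  where
  completed-square : ∀ τ F a b → - ((τ * τ - F) * b * b) ≡ (a * a + + 2 * τ * a * b + F * b * b) - (a + τ * b) * (a + τ * b)
  completed-square = solve-∀

odd≡square⇒≡1 : ∀ {m x} w → + 2 ∣ m → m ∣ + 8 → x ≡ w * w [mod m ] → Odd x → x ≡ + 1 [mod m ]
odd≡square⇒≡1 {m} {x} w 2∣m m∣8 x≡w² x-odd = begin
  x      ≈⟨ x≡w² ⟩
  w * w  ≈⟨ ∣-trans m∣8 (odd²≡1-mod-8 w-odd) ⟩
  + 1    ∎
  where
  open ≡-mod-Reasoning m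
  w-odd : Odd w
  w-odd = invertible-mod-2⇒odd w
    (mod-trans {a = w * w} {x} (mod-sym {a = x} {w * w} (∣-trans 2∣m x≡w²)) (odd⇒≡1-mod-2 x-odd))

-- x is, modulo 8, an odd value of the form; by Hensel this makes any u with u₃ = x a norm of a unit.
Represents : (T F x : ℤ) → Set
Represents T F x = Σ ℤ λ α → Σ ℤ λ β → Odd (normForm T F α β) × x ≡ normForm T F α β [mod + 8 ]

normForm-1-0 : ∀ T F → normForm T F (+ 1) (+ 0) ≡ + 1
normForm-1-0 T F = unfolded T F
  where
  unfolded : ∀ T F → + 1 * + 1 + T * + 1 * + 0 + F * + 0 * + 0 ≡ + 1
  unfolded = solve-∀

odd-normForm-1-0 : ∀ T F → Odd (normForm T F (+ 1) (+ 0))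
odd-normForm-1-0 T F = + 0 , normForm-1-0 T F

represents-pair : ∀ T F x α β α' β' → Odd (normForm T F α β) →
                  normForm T F α' β' ≡ normForm T F α β + + 4 [mod + 8 ] →
                  x ≡ normForm T F α β [mod + 4 ] → Represents T F x
represents-pair T F x α β α' β' N-odd N'≡N+4 x≡N with mod-split {a = x} x≡N
... | inj₁ x≡N[8] = α , β , N-odd , x≡N[8]
... | inj₂ x≡N+4 = α' , β' , ≡1-mod-2⇒odd N'≡1 , mod-trans {a = x} {N + + 4} x≡N+4 (mod-sym {a = N'} {N + + 4} N'≡N+4)
  where
  N = normForm T F α β
  N' = normForm T F α' β'
  N'≡1 : N' ≡ + 1 [mod + 2 ]
  N'≡1 = begin
    N'       ≈⟨ ∣-trans (divides (+ 4) refl) N'≡N+4 ⟩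
    N + + 4  ≈⟨ divides (+ 2) (plus-four N) ⟩
    N        ≈⟨ odd⇒≡1-mod-2 N-odd ⟩
    + 1      ∎
    where
    open ≡-mod-Reasoning (+ 2)
    plus-four : ∀ N → (N + + 4) - N ≡ + 2 * + 2
    plus-four = solve-∀

represents-1+8 : ∀ T F x → x ≡ + 1 [mod + 8 ] → Represents T F x
represents-1+8 T F x x≡1 =
  + 1 , + 0 , odd-normForm-1-0 T F , subst (λ N → x ≡ N [mod + 8 ]) (sym (normForm-1-0 T F)) x≡1

represents-1+4 : ∀ T F x → (T + F) ≡ + 4 [mod + 8 ] → x ≡ + 1 [mod + 4 ] → Represents T F x
represents-1+4 T F x (divides σ T+F≡4) x≡1 =
  represents-pair T F x (+ 1) (+ 0) (+ 1) (+ 1) (odd-normForm-1-0 T F) (divides σ N'≡N+4)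
    (subst (λ N → x ≡ N [mod + 4 ]) (sym (normForm-1-0 T F)) x≡1)
  where
  difference : ∀ T F → (+ 1 * + 1 + T * + 1 * + 1 + F * + 1 * + 1) - ((+ 1 * + 1 + T * + 1 * + 0 + F * + 0 * + 0) + + 4) ≡ (T + F) - + 4
  difference = solve-∀
  N'≡N+4 : normForm T F (+ 1) (+ 1) - (normForm T F (+ 1) (+ 0) + + 4) ≡ σ * + 8
  N'≡N+4 = trans (difference T F) T+F≡4

-- For odd x ≡ 1 (mod 4) the pair is N(1,0) = 1, N(1,2) ≡ 5; for x ≡ 3 (mod 4) it is N(1,1), N(-1,1).
represents-odd : ∀ T F x → T ≡ + 2 [mod + 4 ] → + 4 ∣ F → Odd x → Represents T F x
represents-odd T F x (divides τ T≡2) (divides φ F≡0) x-odd with mod-split {a = x} (odd⇒≡1-mod-2 x-odd)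
... | inj₁ x≡1 = represents-pair T F x (+ 1) (+ 0) (+ 1) (+ 2) (odd-normForm-1-0 T F) (divides (τ + + 2 * φ) N'≡N+4)
                   (subst (λ N → x ≡ N [mod + 4 ]) (sym (normForm-1-0 T F)) x≡1)
  where
  open ≡-Reasoning
  difference : ∀ T F → (+ 1 * + 1 + T * + 1 * + 2 + F * + 2 * + 2) - ((+ 1 * + 1 + T * + 1 * + 0 + F * + 0 * + 0) + + 4) ≡ + 2 * (T - + 2) + + 4 * F
  difference = solve-∀
  collect : ∀ τ φ → + 2 * (τ * + 4) + + 4 * (φ * + 4) ≡ (τ + + 2 * φ) * + 8
  collect = solve-∀
  N'≡N+4 : normForm T F (+ 1) (+ 2) - (normForm T F (+ 1) (+ 0) + + 4) ≡ (τ + + 2 * φ) * + 8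
  N'≡N+4 = begin
    normForm T F (+ 1) (+ 2) - (normForm T F (+ 1) (+ 0) + + 4)  ≡⟨ difference T F ⟩
    + 2 * (T - + 2) + + 4 * F                                      ≡⟨ cong₂ (λ X Y → + 2 * X + + 4 * Y) T≡2 F≡0 ⟩
    + 2 * (τ * + 4) + + 4 * (φ * + 4)                              ≡⟨ collect τ φ ⟩
    (τ + + 2 * φ) * + 8                                            ∎
... | inj₂ x≡3 = represents-pair T F x (+ 1) (+ 1) (- + 1) (+ 1) N-odd (divides (- (τ + + 1)) N'≡N+4) x≡N
  where
  N = normForm T F (+ 1) (+ 1)
  N≡3+4[τ+φ] : N ≡ + 3 + + 4 * (τ + φ)
  N≡3+4[τ+φ] = begin
    N                         ≡⟨ unfold T F ⟩
    + 3 + (T - + 2) + F       ≡⟨ cong₂ (λ X Y → + 3 + X + Y) T≡2 F≡0 ⟩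
    + 3 + τ * + 4 + φ * + 4   ≡⟨ collect τ φ ⟩
    + 3 + + 4 * (τ + φ)       ∎
    where
    open ≡-Reasoning
    unfold : ∀ T F → + 1 * + 1 + T * + 1 * + 1 + F * + 1 * + 1 ≡ + 3 + (T - + 2) + F
    unfold = solve-∀
    collect : ∀ τ φ → + 3 + τ * + 4 + φ * + 4 ≡ + 3 + + 4 * (τ + φ)
    collect = solve-∀
  N-odd : Odd N
  N-odd = + 1 + + 2 * (τ + φ) , trans N≡3+4[τ+φ] (regroup τ φ)
    where
    regroup : ∀ τ φ → + 3 + + 4 * (τ + φ) ≡ + 2 * (+ 1 + + 2 * (τ + φ)) + + 1
    regroup = solve-∀
  x≡N : x ≡ N [mod + 4 ]
  x≡N = begin
    x                    ≈⟨ x≡3 ⟩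
    + 3                  ≈⟨ divides (τ + φ) (regroup τ φ) ⟨
    + 3 + + 4 * (τ + φ)  ≡⟨ N≡3+4[τ+φ] ⟨
    N                    ∎
    where
    open ≡-mod-Reasoning (+ 4)
    regroup : ∀ τ φ → (+ 3 + + 4 * (τ + φ)) - + 3 ≡ (τ + φ) * + 4
    regroup = solve-∀
  N'≡N+4 : normForm T F (- + 1) (+ 1) - (N + + 4) ≡ - (τ + + 1) * + 8
  N'≡N+4 = begin
    normForm T F (- + 1) (+ 1) - (N + + 4)  ≡⟨ difference T F ⟩
    - (+ 2 * (T - + 2)) - + 8               ≡⟨ cong (λ X → - (+ 2 * X) - + 8) T≡2 ⟩
    - (+ 2 * (τ * + 4)) - + 8               ≡⟨ collect τ ⟩
    - (τ + + 1) * + 8                       ∎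
    where
    open ≡-Reasoning
    difference : ∀ T F → (- + 1 * - + 1 + T * - + 1 * + 1 + F * + 1 * + 1) - ((+ 1 * + 1 + T * + 1 * + 1 + F * + 1 * + 1) + + 4) ≡ - (+ 2 * (T - + 2)) - + 8
    difference = solve-∀
    collect : ∀ τ → - (+ 2 * (τ * + 4)) - + 8 ≡ - (τ + + 1) * + 8
    collect = solve-∀

cofactor-odd : ∀ {f} g k → f ≡ g ℕ.* k → ¬ ((2 ℕ.* k) ∣ℕ f) → Odd (+ g)
cofactor-odd {f} g k f≡gk 2k∤f with parity (+ g)
... | inj₂ g-odd = g-odd
... | inj₁ (h , g≡2h) = ⊥-elim (2k∤f (∣⇒∣ᵤ {+ (2 ℕ.* k)} {+ f} (divides h f≡h·2k)))
  where
  open ≡-Reasoning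
  regroup : ∀ h k → + 2 * h * k ≡ h * (+ 2 * k)
  regroup = solve-∀
  f≡h·2k : + f ≡ h * + (2 ℕ.* k)
  f≡h·2k = begin
    + f              ≡⟨ cong +_ f≡gk ⟩
    + (g ℕ.* k)      ≡⟨ ℤP.pos-* g k ⟩
    + g * + k        ≡⟨ cong (_* + k) g≡2h ⟩
    + 2 * h * + k    ≡⟨ regroup h (+ k) ⟩
    h * (+ 2 * + k)  ≡⟨ cong (h *_) (ℤP.pos-* 2 k) ⟨
    h * + (2 ℕ.* k)  ∎

disc-parity : ∀ t n → (Even t × + 2 ∣ t * t - + 4 * n) ⊎ (Odd t × ¬ (+ 2 ∣ t * t - + 4 * n))
disc-parity t n with parity t
... | inj₁ (s , refl) = inj₁ ((s , refl) , divides (+ 2 * s * s - + 2 * n) (even-disc s n))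
  where
  even-disc : ∀ s n → + 2 * s * (+ 2 * s) - + 4 * n ≡ (+ 2 * s * s - + 2 * n) * + 2
  even-disc = solve-∀
... | inj₂ (s , refl) = inj₂ ((s , refl) , λ 2∣disc → even⇒¬odd (2∣⇒even 2∣disc) (+ 2 * s * s + + 2 * s - + 2 * n , odd-disc s n))
  where
  odd-disc : ∀ s n → (+ 2 * s + + 1) * (+ 2 * s + + 1) - + 4 * n ≡ + 2 * (+ 2 * s * s + + 2 * s - + 2 * n) + + 1
  odd-disc = solve-∀

coefficients-i : ∀ φ G t n → φ ≡ + 2 * G → Odd G → Odd t → (φ * t) ≡ + 2 [mod + 4 ] × + 4 ∣ φ * φ * n
coefficients-i _ _ _ n refl (h , refl) (s , refl) =
  divides (+ 2 * h * s + h + s) (T-form h s) , divides ((+ 2 * h + + 1) * (+ 2 * h + + 1) * n) (F-form h n)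
  where
  T-form : ∀ h s → + 2 * (+ 2 * h + + 1) * (+ 2 * s + + 1) - + 2 ≡ (+ 2 * h * s + h + s) * + 4
  T-form = solve-∀
  F-form : ∀ h n → + 2 * (+ 2 * h + + 1) * (+ 2 * (+ 2 * h + + 1)) * n ≡ (+ 2 * h + + 1) * (+ 2 * h + + 1) * n * + 4
  F-form = solve-∀

coefficients-ii : ∀ φ G t n c → φ ≡ + 2 * G → Odd G → Even t → (t * t - + 4 * n) - + 12 ≡ c * + 16 →
                  (φ * t + φ * φ * n) ≡ + 4 [mod + 8 ] × + 4 ∣ φ * t × + 4 ∣ φ * φ * n
coefficients-ii _ _ _ n c refl (h , refl) (s , refl) disc≡12 =
  divides (e - + 2 - + 6 * h * h - + 6 * h - + 2 * c * G * G) T+F≡4 ,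
  divides (G * s) (T-form G s) , divides (G * G * n) (F-form G n)
  where
  open ≡-Reasoning
  G = + 2 * h + + 1
  e = proj₁ (even-*-suc (G * s))
  T-form : ∀ G s → + 2 * G * (+ 2 * s) ≡ G * s * + 4
  T-form = solve-∀
  F-form : ∀ G n → + 2 * G * (+ 2 * G) * n ≡ G * G * n * + 4
  F-form = solve-∀
  -- n is eliminated through the discriminant: 4G²n = G²(4s² - 12) - G²(disc - 12).
  eliminate-n : ∀ G s n → + 2 * G * (+ 2 * s) + + 2 * G * (+ 2 * G) * n - + 4 ≡
                + 4 * ((G * s) * (G * s + + 1)) - + 4 - + 12 * G * G - G * G * ((+ 2 * s * (+ 2 * s) - + 4 * n) - + 12)
  eliminate-n = solve-∀
  collect : ∀ h e c → + 4 * (+ 2 * e) - + 4 - + 12 * (+ 2 * h + + 1) * (+ 2 * h + + 1) - (+ 2 * h + + 1) * (+ 2 * h + + 1) * (c * + 16) ≡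
            (e - + 2 - + 6 * h * h - + 6 * h - + 2 * c * (+ 2 * h + + 1) * (+ 2 * h + + 1)) * + 8
  collect = solve-∀
  T+F≡4 : (+ 2 * G * (+ 2 * s) + + 2 * G * (+ 2 * G) * n) - + 4 ≡ (e - + 2 - + 6 * h * h - + 6 * h - + 2 * c * G * G) * + 8
  T+F≡4 = begin
    + 2 * G * (+ 2 * s) + + 2 * G * (+ 2 * G) * n - + 4
      ≡⟨ eliminate-n G s n ⟩
    + 4 * ((G * s) * (G * s + + 1)) - + 4 - + 12 * G * G - G * G * ((+ 2 * s * (+ 2 * s) - + 4 * n) - + 12)
      ≡⟨ cong₂ (λ X Y → + 4 * X - + 4 - + 12 * G * G - G * G * Y) (proj₂ (even-*-suc (G * s))) disc≡12 ⟩
    + 4 * (+ 2 * e) - + 4 - + 12 * G * G - G * G * (c * + 16)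
      ≡⟨ collect h e c ⟩
    (e - + 2 - + 6 * h * h - + 6 * h - + 2 * c * G * G) * + 8 ∎

coefficients-iii : ∀ φ G t n → φ ≡ + 4 * G → Odd G → Odd t →
                   (φ * t + φ * φ * n) ≡ + 4 [mod + 8 ] × + 4 ∣ φ * t × + 4 ∣ φ * φ * n
coefficients-iii _ _ _ n refl (h , refl) (s , refl) =
  divides (+ 2 * h * s + h + s + + 2 * G * G * n) (T+F-form h s n) ,
  divides (G * (+ 2 * s + + 1)) (T-form G (+ 2 * s + + 1)) , divides (+ 4 * G * G * n) (F-form G n)
  where
  G = + 2 * h + + 1
  T+F-form : ∀ h s n → + 4 * (+ 2 * h + + 1) * (+ 2 * s + + 1) + + 4 * (+ 2 * h + + 1) * (+ 4 * (+ 2 * h + + 1)) * n - + 4 ≡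
             (+ 2 * h * s + h + s + + 2 * (+ 2 * h + + 1) * (+ 2 * h + + 1) * n) * + 8
  T+F-form = solve-∀
  T-form : ∀ G t → + 4 * G * t ≡ G * t * + 4
  T-form = solve-∀
  F-form : ∀ G n → + 4 * G * (+ 4 * G) * n ≡ + 4 * G * G * n * + 4
  F-form = solve-∀

-- With f = 2G the half-trace τ = G t satisfies τ² - F = G² D_K, and 32 ∣ f² D_K = 4 G² D_K.
coefficients-iv : ∀ φ G t n DK → φ ≡ + 2 * G → t * t - + 4 * n ≡ DK → + 32 ∣ φ * φ * DK →
                  φ * t ≡ + 2 * (G * t) × + 8 ∣ (G * t) * (G * t) - φ * φ * n
coefficients-iv _ G t n _ refl refl 32∣f²D =
  reassoc G t , ∣-respʳ (sym (half-disc G t n)) (*-cancelʳ-∣ (+ 4) (∣-respʳ (scale G t n) 32∣f²D))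
  where
  reassoc : ∀ G t → + 2 * G * t ≡ + 2 * (G * t)
  reassoc = solve-∀
  half-disc : ∀ G t n → (G * t) * (G * t) - + 2 * G * (+ 2 * G) * n ≡ G * G * (t * t - + 4 * n)
  half-disc = solve-∀
  scale : ∀ G t n → + 2 * G * (+ 2 * G) * (t * t - + 4 * n) ≡ G * G * (t * t - + 4 * n) * + 4
  scale = solve-∀

-- Norms of units of O_{f,p}

module Norm (p : ℕ) (t n : ℤ) (f : ℕ) where
  open Order p t n f

  T F : ℤ
  T = + f * t
  F = + f * + f * n

  normO-cong : ∀ x y → x ≈O y → normO x ≈ₚ normO y
  normO-cong (a , b) (c , d) (a≈c , b≈d) k =
    normForm-cong T F (seq a k) (seq b k) (seq c k) (seq d k) (a≈c k) (b≈d k)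

  normO-* : ∀ x y → normO (x *O y) ≈ₚ normO x *ₚ normO y
  normO-* x@(a , b) y@(c , d) = pointwise⇒≈ₚ (normO (x *O y)) (normO x *ₚ normO y)
    (λ k → multiplicative T F (seq a k) (seq b k) (seq c k) (seq d k))
    where
    multiplicative : ∀ T F a b c d →
      (a * c + - F * b * d) * (a * c + - F * b * d) + T * (a * c + - F * b * d) * (a * d + b * c + T * b * d)
        + F * (a * d + b * c + T * b * d) * (a * d + b * c + T * b * d) ≡
      (a * a + T * a * b + F * b * b) * (c * c + T * c * d + F * d * d)
    multiplicative = solve-∀

  normO-one : normO oneO ≈ₚ ι (+ 1)
  normO-one = pointwise⇒≈ₚ (normO oneO) (ι (+ 1)) (λ _ → normForm-1-0 T F)

  IsUnitO⇒IsUnitₚ-normO : ∀ x → IsUnitO x → IsUnitₚ (normO x)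
  IsUnitO⇒IsUnitₚ-normO x (y , xy≈1) = normO y , (begin
    normO x *ₚ normO y  ≈⟨ normO-* x y ⟨
    normO (x *O y)      ≈⟨ normO-cong (x *O y) oneO xy≈1 ⟩
    normO oneO          ≈⟨ normO-one ⟩
    ι (+ 1)             ∎)
    where open ≈ₚ-Reasoning p

  -- The inverse of a + bθ is its conjugate (a + T b) - bθ divided by the norm.
  IsUnitₚ-normO⇒IsUnitO : ∀ x → IsUnitₚ (normO x) → IsUnitO x
  IsUnitₚ-normO⇒IsUnitO x@(a , b) (v , Nv≈1) = y , xy₁≈1 , xy₂≈0
    where
    y : Ofp
    y = ((a +ₚ ι T *ₚ b) *ₚ v , ι (- + 1) *ₚ b *ₚ v)
    first : ∀ T F a b v → a * ((a + T * b) * v) + - F * b * (- + 1 * b * v) ≡ (a * a + T * a * b + F * b * b) * v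
    first = solve-∀
    second : ∀ T a b v → a * (- + 1 * b * v) + b * ((a + T * b) * v) + T * b * (- + 1 * b * v) ≡ + 0
    second = solve-∀
    xy₁≈1 : proj₁ (x *O y) ≈ₚ ι (+ 1)
    xy₁≈1 = begin
      proj₁ (x *O y)   ≈⟨ pointwise⇒≈ₚ (proj₁ (x *O y)) (normO x *ₚ v) (λ k → first T F (seq a k) (seq b k) (seq v k)) ⟩
      normO x *ₚ v     ≈⟨ Nv≈1 ⟩
      ι (+ 1)          ∎
      where open ≈ₚ-Reasoning p
    xy₂≈0 : proj₂ (x *O y) ≈ₚ ι (+ 0)
    xy₂≈0 = pointwise⇒≈ₚ (proj₂ (x *O y)) (ι (+ 0)) (λ k → second T (seq a k) (seq b k) (seq v k))

  InNormUnits⇒IsUnitₚ : ∀ u → InNormUnits u → IsUnitₚ u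
  InNormUnits⇒IsUnitₚ u (x , x-unit , Nx≈u) = IsUnitₚ-resp-≈ₚ (normO x) u Nx≈u (IsUnitO⇒IsUnitₚ-normO x x-unit)

  unit-norm⇒InNormUnits : ∀ u x → normO x ≈ₚ u → IsUnitₚ u → InNormUnits u
  unit-norm⇒InNormUnits u x Nx≈u u-unit =
    x , IsUnitₚ-normO⇒IsUnitO x (IsUnitₚ-resp-≈ₚ u (normO x) (≈ₚ-sym (normO x) u Nx≈u) u-unit) , Nx≈u

  normO-of-ι : ∀ y → normO (y , ι (+ 0)) ≈ₚ y *ₚ y
  normO-of-ι y = pointwise⇒≈ₚ (normO (y , ι (+ 0))) (y *ₚ y) (λ k → unfold T F (seq y k))
    where
    unfold : ∀ T F a → a * a + T * a * + 0 + F * + 0 * + 0 ≡ a * a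
    unfold = solve-∀

  IsUnitSquareₚ⇒InNormUnits : ∀ u → IsUnitSquareₚ u → InNormUnits u
  IsUnitSquareₚ⇒InNormUnits u (y , y-unit , u≈y²) =
    unit-norm⇒InNormUnits u (y , ι (+ 0)) (begin
      normO (y , ι (+ 0))  ≈⟨ normO-of-ι y ⟩
      y *ₚ y               ≈⟨ u≈y² ⟨
      u                    ∎)
      (IsUnitₚ-resp-≈ₚ (y *ₚ y) u (≈ₚ-sym u (y *ₚ y) u≈y²) (IsUnitₚ-* y y y-unit y-unit))
    where open ≈ₚ-Reasoning p

  InNormUnits⇒IsUnitSquareₚ : Odd (+ p) → + p ∣ + f → ∀ u → InNormUnits u → IsUnitSquareₚ u
  InNormUnits⇒IsUnitSquareₚ p-odd p∣f u u∈N@(x@(a , b) , _ , Nx≈u) =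
    square-mod-p⇒IsUnitSquareₚ u (seq a 1) p-odd (InNormUnits⇒IsUnitₚ u u∈N) (begin
      seq u 1                          ≈⟨ ≈ₚ⇒≡-mod-p {x = normO x} {u} Nx≈u ⟨
      normForm T F (seq a 1) (seq b 1)  ≈⟨ normForm≡square T F (seq a 1) (seq b 1) p∣T p∣F ⟩
      seq a 1 * seq a 1                ∎)
    where
    open ≡-mod-Reasoning (+ p)
    p∣T : + p ∣ T
    p∣T = ∣m⇒∣m*n t p∣f
    p∣F : + p ∣ F
    p∣F = ∣m⇒∣m*n n (∣m⇒∣m*n (+ f) p∣f)

module Norm₂ (t n : ℤ) (f : ℕ) where
  open Order 2 t n f
  open Norm 2 t n f

  InNormUnits⇒In1+ : ∀ j (w : ℤ → ℤ → ℤ) → 2 ^⁺ suc j ∣ + 8 →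
                     (∀ a b → normForm T F a b ≡ w a b * w a b [mod 2 ^⁺ suc j ]) →
                     ∀ u → InNormUnits u → (In1+ 2 ^⁺ suc j ℤₚ) u
  InNormUnits⇒In1+ j w 2ʲ⁺¹∣8 N≡w² u u∈N@((a , b) , _ , Nx≈u) = In1+-of-digits u (suc j) digit≡1
    where
    digit≡1 : ∀ k → seq u (suc j ℕ.+ k) ≡ + 1 [mod 2 ^⁺ suc j ]
    digit≡1 k = odd≡square⇒≡1 (w aᵢ bᵢ) (∣-^⁺-suc 2 j) 2ʲ⁺¹∣8 u≡w² (unit-digit-odd u (InNormUnits⇒IsUnitₚ u u∈N) (j ℕ.+ k))
      where
      open ≡-mod-Reasoning (2 ^⁺ suc j)
      i = suc j ℕ.+ k
      aᵢ = seq a i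
      bᵢ = seq b i
      u≡w² : seq u i ≡ w aᵢ bᵢ * w aᵢ bᵢ [mod 2 ^⁺ suc j ]
      u≡w² = begin
        seq u i           ≈⟨ ∣-trans (^⁺-∣-+ˡ 2 (suc j) k) (Nx≈u i) ⟨
        normForm T F aᵢ bᵢ ≈⟨ N≡w² aᵢ bᵢ ⟩
        w aᵢ bᵢ * w aᵢ bᵢ  ∎

  Represents⇒InNormUnits : ∀ u → Represents T F (seq u 3) → InNormUnits u
  Represents⇒InNormUnits u (α , β , N-odd , u₃≡N) with hensel-√-mod-8 u (normForm T F α β) N-odd u₃≡N
  ... | y , y-unit , u≈Ny² = unit-norm⇒InNormUnits u x Nx≈u u-unit
    where
    open ≈ₚ-Reasoning 2
    N = normForm T F α β
    x : Ofp
    x = (ι α , ι β) *O (y , ι (+ 0))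
    scaled : ∀ T F α β y →
      (α * y + - F * β * + 0) * (α * y + - F * β * + 0) + T * (α * y + - F * β * + 0) * (α * + 0 + β * y + T * β * + 0)
        + F * (α * + 0 + β * y + T * β * + 0) * (α * + 0 + β * y + T * β * + 0) ≡
      (α * α + T * α * β + F * β * β) * y * y
    scaled = solve-∀
    Nx≈u : normO x ≈ₚ u
    Nx≈u = begin
      normO x          ≈⟨ pointwise⇒≈ₚ (normO x) (ι N *ₚ y *ₚ y) (λ k → scaled T F α β (seq y k)) ⟩
      ι N *ₚ y *ₚ y    ≈⟨ u≈Ny² ⟨
      u                ∎
    N-unit : IsUnitₚ (ι {2} N)
    N-unit = invertible-mod-p⇒unit (ι N) (+ 1) (subst (λ X → X ≡ + 1 [mod + 2 ]) (sym (ℤP.*-identityʳ N)) (odd⇒≡1-mod-2 N-odd))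
    u-unit : IsUnitₚ u
    u-unit = IsUnitₚ-resp-≈ₚ (ι N *ₚ y *ₚ y) u (≈ₚ-sym u (ι N *ₚ y *ₚ y) u≈Ny²)
               (IsUnitₚ-* (ι N *ₚ y) y (IsUnitₚ-* (ι N) y N-unit y-unit) y-unit)

  InNormUnits⇔IsUnitₚ : T ≡ + 2 [mod + 4 ] → + 4 ∣ F → ∀ u → InNormUnits u ⇔ IsUnitₚ u
  InNormUnits⇔IsUnitₚ T≡2 4∣F u = mk⇔ (InNormUnits⇒IsUnitₚ u) λ u-unit →
    Represents⇒InNormUnits u (represents-odd T F (seq u 3) T≡2 4∣F (unit-digit-odd u u-unit 2))

  InNormUnits⇔In1+4 : (T + F) ≡ + 4 [mod + 8 ] → + 4 ∣ T → + 4 ∣ F → ∀ u → InNormUnits u ⇔ (In1+ + 4 ℤₚ) u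
  InNormUnits⇔In1+4 T+F≡4 4∣T 4∣F u = mk⇔
    (InNormUnits⇒In1+ 1 (λ a _ → a) (divides (+ 2) refl) (λ a b → normForm≡square T F a b 4∣T 4∣F) u)
    (λ u∈1+4 → Represents⇒InNormUnits u (represents-1+4 T F (seq u 3) T+F≡4 (In1+⇒≡1 (+ 4) u 3 (divides (+ 2) refl) u∈1+4)))

  InNormUnits⇔In1+8 : ∀ τ → T ≡ + 2 * τ → + 8 ∣ τ * τ - F → ∀ u → InNormUnits u ⇔ (In1+ + 8 ℤₚ) u
  InNormUnits⇔In1+8 τ T≡2τ 8∣τ²-F u = mk⇔
    (InNormUnits⇒In1+ 2 (λ a b → a + τ * b) ∣-refl N≡square u)
    (λ u∈1+8 → Represents⇒InNormUnits u (represents-1+8 T F (seq u 3) (In1+⇒≡1 (+ 8) u 3 ∣-refl u∈1+8)))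
    where
    N≡square : ∀ a b → normForm T F a b ≡ (a + τ * b) * (a + τ * b) [mod + 8 ]
    N≡square a b = subst (λ X → normForm X F a b ≡ (a + τ * b) * (a + τ * b) [mod + 8 ])
                     (sym T≡2τ) (normForm≡square-mod-8 τ F a b 8∣τ²-F)

module TwoAdicCases (DK t n : ℤ) (f : ℕ) (disc : t * t - + 4 * n ≡ DK) where
  open Order 2 t n f
  open Norm₂ t n f

  private
    +f≡k*g : ∀ g k → f ≡ g ℕ.* k → + f ≡ + k * + g
    +f≡k*g g k f≡gk = trans (cong +_ f≡gk) (trans (ℤP.pos-* g k) (ℤP.*-comm (+ g) (+ k)))

    odd-DK⇒odd-t : Odd DK → Odd t
    odd-DK⇒odd-t DK-odd with disc-parity t n
    ... | inj₁ (_ , 2∣disc) = ⊥-elim (even⇒¬odd (2∣⇒even (subst (+ 2 ∣_) disc 2∣disc)) DK-odd)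
    ... | inj₂ (t-odd , _) = t-odd

  case-i : 2 ∣ℕ f × ¬ (4 ∣ℕ f) × ¬ (+ 2 ∣ DK) → ∀ u → InNormUnits u ⇔ IsUnitₚ u
  case-i (ℕD.divides g f≡2g , 4∤f , 2∤DK) with
    coefficients-i (+ f) (+ g) t n (+f≡k*g g 2 f≡2g) (cofactor-odd g 2 f≡2g 4∤f) (odd-DK⇒odd-t (¬2∣⇒odd 2∤DK))
  ... | T≡2 , 4∣F = InNormUnits⇔IsUnitₚ T≡2 4∣F

  case-ii : 2 ∣ℕ f × ¬ (4 ∣ℕ f) × DK ≡ + 12 [mod + 16 ] → ∀ u → InNormUnits u ⇔ (In1+ + 4 ℤₚ) u
  case-ii (ℕD.divides g f≡2g , 4∤f , divides c DK-12≡16c) with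
    coefficients-ii (+ f) (+ g) t n c (+f≡k*g g 2 f≡2g) (cofactor-odd g 2 f≡2g 4∤f) t-even disc≡12
    where
    disc≡12 : (t * t - + 4 * n) - + 12 ≡ c * + 16
    disc≡12 = trans (cong (_- + 12) disc) DK-12≡16c
    split : ∀ D c → D - + 12 ≡ c * + 16 → D ≡ (+ 8 * c + + 6) * + 2
    split D c D-12≡16c = trans (add-back D) (trans (cong (_+ + 12) D-12≡16c) (regroup c))
      where
      add-back : ∀ D → D ≡ (D - + 12) + + 12
      add-back = solve-∀
      regroup : ∀ c → c * + 16 + + 12 ≡ (+ 8 * c + + 6) * + 2
      regroup = solve-∀
    t-even : Even t
    t-even with disc-parity t n
    ... | inj₁ (t-even , _) = t-even
    ... | inj₂ (_ , 2∤disc) = ⊥-elim (2∤disc (divides (+ 8 * c + + 6) (split (t * t - + 4 * n) c disc≡12)))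
  ... | T+F≡4 , 4∣T , 4∣F = InNormUnits⇔In1+4 T+F≡4 4∣T 4∣F

  case-iii : 4 ∣ℕ f × ¬ (8 ∣ℕ f) × DK ≡ + 1 [mod + 4 ] → ∀ u → InNormUnits u ⇔ (In1+ + 4 ℤₚ) u
  case-iii (ℕD.divides g f≡4g , 8∤f , DK≡1) with
    coefficients-iii (+ f) (+ g) t n (+f≡k*g g 4 f≡4g) (cofactor-odd g 4 f≡4g 8∤f)
      (odd-DK⇒odd-t (≡1-mod-2⇒odd (∣-trans (divides (+ 2) refl) DK≡1)))
  ... | T+F≡4 , 4∣T , 4∣F = InNormUnits⇔In1+4 T+F≡4 4∣T 4∣F

  case-iv : 2 ∣ℕ f → + 32 ∣ (+ f * + f * DK) → ∀ u → InNormUnits u ⇔ (In1+ + 8 ℤₚ) u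
  case-iv (ℕD.divides g f≡2g) 32∣f²DK with coefficients-iv (+ f) (+ g) t n DK (+f≡k*g g 2 f≡2g) disc 32∣f²DK
  ... | T≡2τ , 8∣τ²-F = InNormUnits⇔In1+8 (+ g * t) T≡2τ 8∣τ²-F

lemma3p3 : (DK t n : ℤ) (f p : ℕ) →
    IsFundamentalDiscriminant DK →
    t * t - + 4 * n ≡ DK →
    1 ≤ f → Prime p → p ∣ℕ f →
    let open Order p t n f in
    ( p ≢ 2 → ∀ (u : ℤₚ p) → InNormUnits u ⇔ IsUnitSquareₚ u )
    ×
    ( p ≡ 2 →
      ( (2 ∣ℕ f × ¬ (4 ∣ℕ f) × ¬ (+ 2 ∣ DK) →
          ∀ (u : ℤₚ p) → InNormUnits u ⇔ IsUnitₚ u)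
      × (2 ∣ℕ f × ¬ (4 ∣ℕ f) × DK ≡ + 12 [mod + 16 ] →
          ∀ (u : ℤₚ p) → InNormUnits u ⇔ (In1+ + 4 ℤₚ) u)
      × (4 ∣ℕ f × ¬ (8 ∣ℕ f) × DK ≡ + 1 [mod + 4 ] →
          ∀ (u : ℤₚ p) → InNormUnits u ⇔ (In1+ + 4 ℤₚ) u)
      × (+ 32 ∣ (+ f * + f * DK) →
          ∀ (u : ℤₚ p) → InNormUnits u ⇔ (In1+ + 8 ℤₚ) u) ) )
lemma3p3 DK t n f p _ disc _ p-prime p∣f =
  (λ p≢2 u → mk⇔ (InNormUnits⇒IsUnitSquareₚ (prime≢2⇒odd p-prime p≢2) (∣ᵤ⇒∣ p∣f) u) (IsUnitSquareₚ⇒InNormUnits u)) ,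
  (λ { refl → case-i , case-ii , case-iii , case-iv p∣f })
  where
  open Norm p t n f
  open TwoAdicCases DK t n f disc
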